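{- Let $T^1$ and $T^2$ be binary trees (in the sense defined in the context) whose root regions are the same set $D$, and run the procedure $\mathbf{combine}(u_0,v_0,w_0)$, where $u_0,v_0$ are the roots of $T^1,T^2$ and $w_0$ is the single (terminal) node of a new tree $\mathbf{T}$ with $A(w_0)=D$. Then at every invocation $\mathbf{combine}(u,v,w)$ occurring during the execution (including the initial one), every terminal node $q$ of $T^1$ with $A(q)\cap A(w)\neq\emptyset$ belongs to the subtree of $T^1$ rooted at $u$, and every terminal node $q$ of $T^2$ with $A(q)\cap A(w)\neq\emptyset$ belongs to the subtree of $T^2$ rooted at $v$.
   Context: A binary tree $T$ is a finite set of nodes with a unique root (no parent); every other node has a parent; a node is internal if it has a left daughter $l(v)$ and a right daughter $r(v)$, otherwise terminal. Each node $v$ has a region $A(v)$: the root's region is given, and each internal node $v$ has a split $c(v)$, a condition that divides $A(v)$ into two complementary sets $L(v)$ and $R(v)$ (both regarded as subsets of the ambient space), with $A(l(v))=L(v)$ and $A(r(v))=R(v)$ (so $A(l(v)) = A(v)\cap L(v)$, $A(r(v))=A(v)\cap R(v)$). Each terminal node $v$ carries a function $f_v$ on $A(v)$; the terminal regions partition the root region, so $T$ defines a function $T(x)=f_v(x)$ for $x\in A(v)$, $v$ terminal. The subtree at $v$ consists of $v$ and, recursively, the daughters of nodes in it. Say a split $c(u)$ partitions a set $A$ if both $A\cap L(u)$ and $A\cap R(u)$ are nonempty. The procedure $\mathbf{collect}(w,v)$ (for a terminal node $w$ of a tree being built and a node $v$ of a tree $T$): if $v$ is internal and $c(v)$ partitions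 $A(w)$, give $w$ the split $c(w)=c(v)$ with daughters $l(w),r(w)$ (regions $A(w)\cap L(v)$, $A(w)\cap R(v)$) and call $\mathbf{collect}(l(w),l(v))$, $\mathbf{collect}(r(w),r(v))$; if $v$ is internal and $A(w)$ meets only one of $L(v),R(v)$, call $\mathbf{collect}$ on $w$ and the corresponding daughter of $v$; if $v$ is terminal, $w$ is matched with $v$. The procedure $\mathbf{combine}(u,v,w)$, with $u$ a node of $T^1$, $v$ a node of $T^2$, $w$ a terminal node of $\mathbf{T}$: (1) If $u$ or $v$ is terminal: if both are, set $F_w=(f_u,f_v)$; if only $u$ is terminal, run $\mathbf{collect}(w,v)$ in $T^2$ and at each resulting terminal node $w'$ (matched with terminal $v'$ of $T^2$) set $F_{w'}=(f_u,f_{v'})$; symmetrically if only $v$ is terminal. (2) Otherwise, if $c(u)$ does not partition $A(w)$, replace $u$ by the daughter of $u$ whose region contains $A(w)$; likewise for $v$; and recurse on $w$ with the resulting nodes (if exactly one was replaced, the other is kept). (3) If both partition $A(w)$ and all four sets $A(w)\cap L(u)\cap L(v)$, $A(w)\cap L(u)\cap R(v)$, $A(w)\cap R(u)\cap L(v)$, $A(w)\cap R(u)\cap R(v)$ are nonempty (crossing), choose one of $u,v$, say $u$, split $w$ by $c(w)=c(u)$ (daughter regions $A(w)\cap L(u)$, $A(w)\cap R(u)$) and call $\mathbf{combine}(l(u),v,l(w))$, $\mathbf{combine}(r(u),v,r(w))$ (symmetrically if $v$ is chosen). (4) If both partition $A(w)$ but they are nested (parallel: exactly one of those four sets is empty),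 choose one, say $u$, split $w$ by $c(u)$; for the daughter of $w$ whose region $c(v)$ still partitions, recurse with the corresponding daughter of $u$ and $v$; for the other daughter of $w$, recurse with the corresponding daughter of $u$ and the daughter of $v$ whose region contains it (symmetrically if $v$ is chosen). (5) If $c(u)$ and $c(v)$ induce the same bipartition of $A(w)$ (identical), split $w$ by $c(u)$ and recurse on each daughter of $w$ with the daughters of $u$ and of $v$ whose regions contain it. -}

module Defs where

open import Data.Bool using (Bool; true; false; _xor_)
open import Data.List using (List; []; _∷_; _++_; [_])
open import Data.Maybe using (Maybe; just; nothing)
open import Data.Product using (Σ; ∃; _×_; _,_)
open import Data.Empty using (⊥)
open import Relation.Nullary using (¬_)
open import Relation.Binary.PropositionalEquality using (_≡_; _≢_)

-- A split c(v) is a Bool-valued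
-- condition s : X → Bool, with L(v) = {x | s x ≡ true} and
-- R(v) = {x | s x ≡ false} (complementary sets).
data Tree (X : Set) (F : Set) : Set where
  leaf : F → Tree X F
  node : (X → Bool) → Tree X F → Tree X F → Tree X F

-- Directions: true = left daughter, false = right daughter.
Path : Set
Path = List Bool

Region : Set → Set₁
Region X = X → Set

_∩_ : {X : Set} → Region X → Region X → Region X
(A ∩ B) x = A x × B x

_⊆_ : {X : Set} → Region X → Region X → Set
A ⊆ B = ∀ x → A x → B x

Nonempty : {X : Set} → Region X → Set
Nonempty A = ∃ λ x → A x

Side : {X : Set} → (X → Bool) → Bool → Region X
Side s b x = s x ≡ b

daughter : {X F : Set} → Bool → Tree X F → Tree X F → Tree X F
daughter true  l r = l
daughter false l r = r

subtreeAt : {X F : Set} → Tree X F → Path → Maybe (Tree X F)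
subtreeAt t [] = just t
subtreeAt (leaf f) (_ ∷ _) = nothing
subtreeAt (node s l r) (b ∷ p) = subtreeAt (daughter b l r) p

region : {X F : Set} → Region X → Tree X F → Path → Region X
region D t [] = D
region D (leaf f) (_ ∷ _) = λ _ → ⊥
region D (node s l r) (b ∷ p) = region (D ∩ Side s b) (daughter b l r) p

Internal : {X F : Set} → Tree X F → Path → (X → Bool) → Set
Internal t p s = ∃ λ l → ∃ λ r → subtreeAt t p ≡ just (node s l r)

Terminal : {X F : Set} → Tree X F → Path → Set
Terminal t p = ∃ λ f → subtreeAt t p ≡ just (leaf f)

InSubtree : Path → Path → Set
InSubtree q u = ∃ λ s → u ++ s ≡ q

Partitions : {X : Set} → (X → Bool) → Region X → Set
Partitions s A = Nonempty (A ∩ Side s true) × Nonempty (A ∩ Side s false)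

Quadrant : {X : Set} → (X → Bool) → (X → Bool) → Region X → Bool → Bool → Set
Quadrant su sv A a b = Nonempty ((A ∩ Side su a) ∩ Side sv b)

Crossing : {X : Set} → (X → Bool) → (X → Bool) → Region X → Set
Crossing su sv A = ∀ a b → Quadrant su sv A a b

Parallel : {X : Set} → (X → Bool) → (X → Bool) → Region X → Set
Parallel su sv A = Σ Bool λ a → Σ Bool λ b →
  ¬ Quadrant su sv A a b ×
  (∀ a' b' → ¬ (a' ≡ a × b' ≡ b) → Quadrant su sv A a' b')

-- su and sv induce the same (unordered) bipartition of A
Identical : {X : Set} → (X → Bool) → (X → Bool) → Region X → Set
Identical su sv A = Σ Bool λ flip → ∀ x → A x → su x ≡ (sv x xor flip)

-- Invoked D T1 T2 u v W : combine(u, v, w) with A(w) = W is invoked at some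
-- point of some execution of combine(root, root, w0), A(w0) = D
-- (all nondeterministic choices of the procedure are allowed).
-- Step (1) (u or v terminal) only calls collect, never combine again.
data Invoked {X F₁ F₂ : Set} (D : Region X) (T₁ : Tree X F₁) (T₂ : Tree X F₂)
     : Path → Path → Region X → Set₁ where
  start : Invoked D T₁ T₂ [] [] D
  step2-both : ∀ {u v W su sv a b} → Invoked D T₁ T₂ u v W →
    Internal T₁ u su → Internal T₂ v sv →
    ¬ Partitions su W → ¬ Partitions sv W →
    W ⊆ region D T₁ (u ++ [ a ]) → W ⊆ region D T₂ (v ++ [ b ]) →
    Invoked D T₁ T₂ (u ++ [ a ]) (v ++ [ b ]) W
  step2-u : ∀ {u v W su sv a} → Invoked D T₁ T₂ u v W →
    Internal T₁ u su → Internal T₂ v sv →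
    ¬ Partitions su W → Partitions sv W →
    W ⊆ region D T₁ (u ++ [ a ]) →
    Invoked D T₁ T₂ (u ++ [ a ]) v W
  step2-v : ∀ {u v W su sv b} → Invoked D T₁ T₂ u v W →
    Internal T₁ u su → Internal T₂ v sv →
    Partitions su W → ¬ Partitions sv W →
    W ⊆ region D T₂ (v ++ [ b ]) →
    Invoked D T₁ T₂ u (v ++ [ b ]) W
  step3-u : ∀ {u v W su sv} (a : Bool) → Invoked D T₁ T₂ u v W →
    Internal T₁ u su → Internal T₂ v sv →
    Partitions su W → Partitions sv W → Crossing su sv W →
    Invoked D T₁ T₂ (u ++ [ a ]) v (W ∩ Side su a)
  step3-v : ∀ {u v W su sv} (b : Bool) → Invoked D T₁ T₂ u v W →
    Internal T₁ u su → Internal T₂ v sv →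
    Partitions su W → Partitions sv W → Crossing su sv W →
    Invoked D T₁ T₂ u (v ++ [ b ]) (W ∩ Side sv b)
  step4-u-keep : ∀ {u v W su sv} (a : Bool) → Invoked D T₁ T₂ u v W →
    Internal T₁ u su → Internal T₂ v sv →
    Partitions su W → Partitions sv W → Parallel su sv W →
    Partitions sv (W ∩ Side su a) →
    Invoked D T₁ T₂ (u ++ [ a ]) v (W ∩ Side su a)
  step4-u-move : ∀ {u v W su sv b} (a : Bool) → Invoked D T₁ T₂ u v W →
    Internal T₁ u su → Internal T₂ v sv →
    Partitions su W → Partitions sv W → Parallel su sv W →
    ¬ Partitions sv (W ∩ Side su a) →
    (W ∩ Side su a) ⊆ region D T₂ (v ++ [ b ]) →
    Invoked D T₁ T₂ (u ++ [ a ]) (v ++ [ b ]) (W ∩ Side su a)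
  step4-v-keep : ∀ {u v W su sv} (b : Bool) → Invoked D T₁ T₂ u v W →
    Internal T₁ u su → Internal T₂ v sv →
    Partitions su W → Partitions sv W → Parallel su sv W →
    Partitions su (W ∩ Side sv b) →
    Invoked D T₁ T₂ u (v ++ [ b ]) (W ∩ Side sv b)
  step4-v-move : ∀ {u v W su sv a} (b : Bool) → Invoked D T₁ T₂ u v W →
    Internal T₁ u su → Internal T₂ v sv →
    Partitions su W → Partitions sv W → Parallel su sv W →
    ¬ Partitions su (W ∩ Side sv b) →
    (W ∩ Side sv b) ⊆ region D T₁ (u ++ [ a ]) →
    Invoked D T₁ T₂ (u ++ [ a ]) (v ++ [ b ]) (W ∩ Side sv b)
  step5 : ∀ {u v W su sv a b} (c : Bool) → Invoked D T₁ T₂ u v W →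
    Internal T₁ u su → Internal T₂ v sv →
    Partitions su W → Partitions sv W → Identical su sv W →
    (W ∩ Side su c) ⊆ region D T₁ (u ++ [ a ]) →
    (W ∩ Side su c) ⊆ region D T₂ (v ++ [ b ]) →
    Invoked D T₁ T₂ (u ++ [ a ]) (v ++ [ b ]) (W ∩ Side su c)

module Submission where

-- Every invocation combine(u, v, w) satisfies the invariant
--   A(w) ⊆ A(u)  and  A(w) ⊆ A(v),
-- because each step of the procedure either moves to a daughter of u (or v)
-- whose region contains A(w), or splits w by the very split c(u) (or c(v))
-- it descends along, and A(w) ∩ (side a of c(u)) ⊆ A(u) ∩ (side a of c(u)),
-- which is the region of the a-daughter of u.  Separately, regions in a
-- binary tree are laminar: the two daughters of a node have disjoint
-- regions, so a terminal node whose region meets the region of a node u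
-- must lie below u.

open import Defs
open import Data.Product using (_×_; _,_; proj₁; proj₂)
open import Data.Bool using (Bool)
open import Data.List using ([]; _∷_; _++_; [_])
open import Relation.Binary.PropositionalEquality using (refl; trans; sym; cong)

region-⊆-root : {X F : Set} (D : Region X) (t : Tree X F) (p : Path) →
  region D t p ⊆ D
region-⊆-root D t            []      x x∈ = x∈
region-⊆-root D (leaf f)     (_ ∷ _) x ()
region-⊆-root D (node s l r) (b ∷ p) x x∈ =
  proj₁ (region-⊆-root (D ∩ Side s b) (daughter b l r) p x x∈)

region-below-side : {X F : Set} (D : Region X) (s : X → Bool) (l r : Tree X F)
  (b : Bool) (p : Path) → region D (node s l r) (b ∷ p) ⊆ Side s b
region-below-side D s l r b p x x∈ =
  proj₂ (region-⊆-root (D ∩ Side s b) (daughter b l r) p x x∈)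

region-daughter : {X F : Set} (D : Region X) (t : Tree X F) (u : Path)
  {s : X → Bool} (a : Bool) → Internal t u s →
  (region D t u ∩ Side s a) ⊆ region D t (u ++ [ a ])
region-daughter D (leaf f)      []      a (_ , _ , ())
region-daughter D (node s l r)  []      a (.l , .r , refl) x x∈ = x∈
region-daughter D (leaf f)      (_ ∷ _) a (_ , _ , ())
region-daughter D (node s' l r) (b ∷ u) a int =
  region-daughter (D ∩ Side s' b) (daughter b l r) u a int

-- At each level both paths must take the
-- side of the split on which the common point lies.
terminal-meets⇒below : {X F : Set} (D : Region X) (t : Tree X F) (u q : Path) →
  Terminal t q → Nonempty (region D t q ∩ region D t u) → InSubtree q u
terminal-meets⇒below D t            []      q        _         _ = q , refl
terminal-meets⇒below D (leaf f)     (_ ∷ _) q        _         (_ , _ , ())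
terminal-meets⇒below D (node s l r) (_ ∷ _) []       (_ , ())  _
terminal-meets⇒below D (node s l r) (b ∷ u) (b' ∷ q) terminal (x , x∈q , x∈u)
  with trans (sym (region-below-side D s l r b' q x x∈q))
             (region-below-side D s l r b u x x∈u)
... | refl with terminal-meets⇒below (D ∩ Side s b) (daughter b l r) u q
                  terminal (x , x∈q , x∈u)
... | (rest , u++rest≡q) = rest , cong (b ∷_) u++rest≡q

cut-⊆-daughter : {X F : Set} (D : Region X) (t : Tree X F) (u : Path)
  {s : X → Bool} {W : Region X} (a : Bool) → Internal t u s →
  W ⊆ region D t u → (W ∩ Side s a) ⊆ region D t (u ++ [ a ])
cut-⊆-daughter D t u a int W⊆u x (x∈W , side) =
  region-daughter D t u a int x (W⊆u x x∈W , side)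

cut-⊆ : {X : Set} {W R : Region X} (S : Region X) → W ⊆ R → (W ∩ S) ⊆ R
cut-⊆ S W⊆R x (x∈W , _) = W⊆R x x∈W

invoked-⊆-regions : {X F₁ F₂ : Set} (D : Region X) (T₁ : Tree X F₁)
  (T₂ : Tree X F₂) {u v : Path} {W : Region X} →
  Invoked D T₁ T₂ u v W → (W ⊆ region D T₁ u) × (W ⊆ region D T₂ v)
invoked-⊆-regions D T₁ T₂ start = (λ _ x∈ → x∈) , (λ _ x∈ → x∈)
invoked-⊆-regions D T₁ T₂ (step2-both _ _ _ _ _ W⊆u' W⊆v') = W⊆u' , W⊆v'
invoked-⊆-regions D T₁ T₂ (step2-u i _ _ _ _ W⊆u') =
  W⊆u' , proj₂ (invoked-⊆-regions D T₁ T₂ i)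
invoked-⊆-regions D T₁ T₂ (step2-v i _ _ _ _ W⊆v') =
  proj₁ (invoked-⊆-regions D T₁ T₂ i) , W⊆v'
invoked-⊆-regions D T₁ T₂ (step3-u {u = u} a i iu _ _ _ _)
  with invoked-⊆-regions D T₁ T₂ i
... | W⊆u , W⊆v = cut-⊆-daughter D T₁ u a iu W⊆u , cut-⊆ _ W⊆v
invoked-⊆-regions D T₁ T₂ (step3-v {v = v} b i _ iv _ _ _)
  with invoked-⊆-regions D T₁ T₂ i
... | W⊆u , W⊆v = cut-⊆ _ W⊆u , cut-⊆-daughter D T₂ v b iv W⊆v
invoked-⊆-regions D T₁ T₂ (step4-u-keep {u = u} a i iu _ _ _ _ _)
  with invoked-⊆-regions D T₁ T₂ i
... | W⊆u , W⊆v = cut-⊆-daughter D T₁ u a iu W⊆u , cut-⊆ _ W⊆v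
invoked-⊆-regions D T₁ T₂ (step4-u-move {u = u} a i iu _ _ _ _ _ W⊆v')
  with invoked-⊆-regions D T₁ T₂ i
... | W⊆u , _ = cut-⊆-daughter D T₁ u a iu W⊆u , W⊆v'
invoked-⊆-regions D T₁ T₂ (step4-v-keep {v = v} b i _ iv _ _ _ _)
  with invoked-⊆-regions D T₁ T₂ i
... | W⊆u , W⊆v = cut-⊆ _ W⊆u , cut-⊆-daughter D T₂ v b iv W⊆v
invoked-⊆-regions D T₁ T₂ (step4-v-move {v = v} b i _ iv _ _ _ _ W⊆u')
  with invoked-⊆-regions D T₁ T₂ i
... | _ , W⊆v = W⊆u' , cut-⊆-daughter D T₂ v b iv W⊆v
invoked-⊆-regions D T₁ T₂ (step5 _ _ _ _ _ _ _ W⊆u' W⊆v') = W⊆u' , W⊆v'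

-- A terminal node of a tree whose region meets A(w) meets A(u) ⊇ A(w),
-- hence lies below u.
lemma1 : {X F₁ F₂ : Set} (D : Region X) (T₁ : Tree X F₁) (T₂ : Tree X F₂)
    {u v : Path} {W : Region X} →
    Invoked D T₁ T₂ u v W →
    (∀ q → Terminal T₁ q → Nonempty (region D T₁ q ∩ W) → InSubtree q u) ×
    (∀ q → Terminal T₂ q → Nonempty (region D T₂ q ∩ W) → InSubtree q v)
lemma1 D T₁ T₂ {u} {v} i =
  (λ q terminal (x , x∈q , x∈W) →
     terminal-meets⇒below D T₁ u q terminal (x , x∈q , W⊆u x x∈W)) ,
  (λ q terminal (x , x∈q , x∈W) →
     terminal-meets⇒below D T₂ v q terminal (x , x∈q , W⊆v x x∈W))
  where
    W⊆u = proj₁ (invoked-⊆-regions D T₁ T₂ i)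
    W⊆v = proj₂ (invoked-⊆-regions D T₁ T₂ i)
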